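{- Every order-complete modal FL-algebra is isomorphic to the modal FL-algebra $(\mathit{Prop}(\mathcal{S}),\subseteq,\otimes,1,\Rightarrow_l,\Rightarrow_r,0,!,?)$ of all propositions of some modal FL-cover system $\mathcal{S}=(S,\preceq,\lhd,\cdot,\varepsilon,0,I,R)$ that is strong, i.e. satisfies $X\otimes Y={\uparrow}(X\cdot Y)$ for all $X,Y\in\mathit{Prop}(\mathcal{S})$. Here, for propositions $X,Y$: $X\otimes Y=j{\uparrow}(X\cdot Y)$, $1={\uparrow}\varepsilon$, $X\Rightarrow_l Y=\{z:z\cdot X\subseteq Y\}$, $X\Rightarrow_r Y=\{z:X\cdot z\subseteq Y\}$, $!X=j{\uparrow}(X\cap I)$, $?X=\{x:\exists y\,(xRy,\ y\in X)\}$, with meets being intersections and joins being $j$ of unions.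
   Context: Modal FL-algebras. A residuated lattice is $(L,\sqsubseteq,\otimes,1,\Rightarrow_l,\Rightarrow_r)$ with $(L,\sqsubseteq)$ a lattice, $(L,\otimes,1)$ a monoid with $\otimes$ monotone, and $a\sqsubseteq b\Rightarrow_l c$ iff $a\otimes b\sqsubseteq c$ iff $b\sqsubseteq a\Rightarrow_r c$. An FL-algebra is a residuated lattice with a distinguished element $0$. A modal FL-algebra is a bounded FL-algebra with unary operations $!,?$ such that for all $a,b$: (s1) $!a\sqsubseteq a$; (s2) $!a\sqsubseteq !!a$; (s3) $!1=1$; (s4) $!(a\sqcap b)=!a\otimes !b$; (s5) $!a\otimes b=b\otimes !a$; (c1) $!(a\Rightarrow_i b)\sqsubseteq ?a\Rightarrow_i ?b$ for $i=l,r$; (c2) $a\sqsubseteq ?a$; (c3) $??a\sqsubseteq ?a$; (c4) $?0\sqsubseteq 0$; (c5) $0\sqsubseteq ?a$. Order-complete means every subset has a join and meet. Cover systems. $(S,\preceq,\lhd)$: a set $S$, a preorder $\preceq$, and $\lhd\subseteq S\times\mathcal{P}(S)$. ${\uparrow}X=\{y:\exists x\in X,\ x\preceq y\}$, ${\uparrow}x={\uparrow}\{x\}$; up-sets satisfy ${\uparrow}X=X$. Cover system axioms: (Existence) each $x$ has a cover $C\subseteq{\uparrow}x$; (Transitivity) $x\lhd C$ and $y\lhd C_y$ for all $y\in C$ imply $x\lhd\bigcup_{y\in C}C_y$; (Refinement) $x\preceq y$ and $x\lhd C$ imply some $C'\subseteq{\uparrow}C$ with $y\lhd C'$. $jX=\{x:\exists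 C\,(x\lhd C\subseteq X)\}$; a proposition is an up-set $X$ with $jX\subseteq X$; $\mathit{Prop}(\mathcal{S})$ is the set of propositions. $X\cdot Y=\{x\cdot y:x\in X,y\in Y\}$, $x\cdot Y=\{x\}\cdot Y$. A residuated cover system $(S,\preceq,\lhd,\cdot,\varepsilon)$ is a cover system with an associative $\preceq$-monotone operation $\cdot$ with identity $\varepsilon$ such that $x\lhd C$ implies $x\cdot y\lhd C\cdot y$ and $y\cdot x\lhd y\cdot C$, and $x\lhd C\subseteq{\uparrow}\varepsilon$ implies $\varepsilon\preceq x$. A modal FL-cover system $(S,\preceq,\lhd,\cdot,\varepsilon,0,I,R)$ has $0\in\mathit{Prop}(\mathcal{S})$, $I\subseteq{\uparrow}\varepsilon$, $R\subseteq S\times S$, with: $(S,\preceq,\lhd,\cdot,\varepsilon)$ a residuated cover system; $I$ closed under $\cdot$ and $\varepsilon\in I$; $\varepsilon\lhd I$; each $x\in I$ has $x=x\cdot x$ and $x\cdot y=y\cdot x$ for all $y$; if $x\preceq y$ and $xRz$ then some $w$ has $z\preceq w$ and $yRw$; if some $x$-cover is included in $\langle R\rangle X=\{u:\exists v\,(uRv, v\in X)\}$ then some $y$ has $xRy$ and a $y$-cover included in $X$; $x\in I$ and $yRz$ imply $(x\cdot y)R(x\cdot z)$ and $(y\cdot x)R(z\cdot x)$; $R$ reflexive and transitive; $xRy\in 0$ implies $x\in0$; $x\in 0$ implies some $y$ with $xRy$ and $y\lhd\emptyset$. -}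

module Defs where

open import Level using (Level; Lift) renaming (suc to lsuc; _⊔_ to _⊔ˡ_)
open import Data.Product using (Σ; Σ-syntax; ∃; _×_; _,_)
open import Data.Empty using (⊥)
open import Data.Unit using (⊤)
open import Relation.Binary.PropositionalEquality using (_≡_)
open import Relation.Binary.Lattice.Structures using (IsBoundedLattice)
open import Algebra.Structures using (IsMonoid)
open import Relation.Unary using (Pred; _∈_; _⊆_; _≐_; _∩_; _∪_; U)
open import Function using (_⇔_)

record ModalFLAlgebra (ℓ : Level) : Set (lsuc ℓ) where
  infix  4 _⊑_
  infixr 6 _⊓_
  infixr 5 _⊔_
  infixl 7 _⊗_
  field
    Carrier : Set ℓ
    _⊑_     : Carrier → Carrier → Set ℓ
    _⊓_ _⊔_ : Carrier → Carrier → Carrier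
    top bot : Carrier
    _⊗_     : Carrier → Carrier → Carrier
    one     : Carrier
    _⇒ₗ_ _⇒ᵣ_ : Carrier → Carrier → Carrier
    zero    : Carrier
    ！ ？   : Carrier → Carrier
    isBoundedLattice : IsBoundedLattice _≡_ _⊑_ _⊔_ _⊓_ top bot
    isMonoid : IsMonoid _≡_ _⊗_ one
    ⊗-mono   : ∀ {a a′ b b′} → a ⊑ a′ → b ⊑ b′ → a ⊗ b ⊑ a′ ⊗ b′
    resₗ : ∀ a b c → (a ⊑ b ⇒ₗ c) ⇔ (a ⊗ b ⊑ c)
    resᵣ : ∀ a b c → (b ⊑ a ⇒ᵣ c) ⇔ (a ⊗ b ⊑ c)
    s1 : ∀ a → ！ a ⊑ a
    s2 : ∀ a → ！ a ⊑ ！ (！ a)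
    s3 : ！ one ≡ one
    s4 : ∀ a b → ！ (a ⊓ b) ≡ ！ a ⊗ ！ b
    s5 : ∀ a b → ！ a ⊗ b ≡ b ⊗ ！ a
    c1ₗ : ∀ a b → ！ (a ⇒ₗ b) ⊑ ？ a ⇒ₗ ？ b
    c1ᵣ : ∀ a b → ！ (a ⇒ᵣ b) ⊑ ？ a ⇒ᵣ ？ b
    c2 : ∀ a → a ⊑ ？ a
    c3 : ∀ a → ？ (？ a) ⊑ ？ a
    c4 : ？ zero ⊑ zero
    c5 : ∀ a → zero ⊑ ？ a

module _ {ℓ : Level} (A : ModalFLAlgebra ℓ) where
  open ModalFLAlgebra A

  IsJoin : Pred Carrier ℓ → Carrier → Set ℓ
  IsJoin P a = (∀ x → x ∈ P → x ⊑ a) × (∀ b → (∀ x → x ∈ P → x ⊑ b) → a ⊑ b)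

  IsMeet : Pred Carrier ℓ → Carrier → Set ℓ
  IsMeet P a = (∀ x → x ∈ P → a ⊑ x) × (∀ b → (∀ x → x ∈ P → b ⊑ x) → b ⊑ a)

  OrderComplete : Set (lsuc ℓ)
  OrderComplete = ∀ (P : Pred Carrier ℓ) → (∃ λ a → IsJoin P a) × (∃ λ a → IsMeet P a)

module CoverNotions {ℓ : Level} {S : Set ℓ}
  (_⪯_ : S → S → Set ℓ) (_⊲_ : S → Pred S ℓ → Set ℓ) (_·_ : S → S → S) where

  ↑ : ∀ {a} → Pred S a → Pred S (ℓ ⊔ˡ a)
  ↑ X y = ∃ λ x → x ∈ X × x ⪯ y

  ↑₁ : S → Pred S ℓ
  ↑₁ x y = x ⪯ y

  ∅ℓ : Pred S ℓ
  ∅ℓ _ = Lift ℓ ⊥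

  j : ∀ {a} → Pred S a → Pred S (lsuc ℓ ⊔ˡ a)
  j X x = Σ (Pred S ℓ) λ C → x ⊲ C × C ⊆ X

  -- up-sets: ↑X = X (↑X ⊆ X; the converse holds by reflexivity)
  IsUpSet : ∀ {a} → Pred S a → Set (ℓ ⊔ˡ a)
  IsUpSet X = ↑ X ⊆ X

  IsProposition : ∀ {a} → Pred S a → Set (lsuc ℓ ⊔ˡ a)
  IsProposition X = IsUpSet X × (j X ⊆ X)

  _·ₛ_ : ∀ {a b} → Pred S a → Pred S b → Pred S (ℓ ⊔ˡ a ⊔ˡ b)
  (X ·ₛ Y) z = ∃ λ x → ∃ λ y → x ∈ X × y ∈ Y × z ≡ x · y

  ｛_｝ℓ : S → Pred S ℓ
  ｛ x ｝ℓ y = y ≡ x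

record ModalFLCoverSystem (ℓ : Level) : Set (lsuc ℓ) where
  infix 4 _⪯_ _⊲_
  infixl 7 _·_
  field
    S   : Set ℓ
    _⪯_ : S → S → Set ℓ
    _⊲_ : S → Pred S ℓ → Set ℓ
    _·_ : S → S → S
    ε   : S
    𝟎   : Pred S ℓ
    I   : Pred S ℓ
    R   : S → S → Set ℓ

  open CoverNotions _⪯_ _⊲_ _·_ public

  ⟨R⟩ : ∀ {a} → Pred S a → Pred S (ℓ ⊔ˡ a)
  ⟨R⟩ X u = ∃ λ v → R u v × v ∈ X

  field
    ⪯-refl  : ∀ x → x ⪯ x
    ⪯-trans : ∀ {x y z} → x ⪯ y → y ⪯ z → x ⪯ z
    -- covers are subsets: ⊲ respects extensional equality of subsets
    ⊲-ext : ∀ {x C C′} → x ⊲ C → C ≐ C′ → x ⊲ C′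
    existence    : ∀ x → ∃ λ C → x ⊲ C × C ⊆ ↑₁ x
    transitivity : ∀ {x C} → x ⊲ C →
                   (D : ∀ y → y ∈ C → Pred S ℓ) → (∀ y (p : y ∈ C) → y ⊲ D y p) →
                   x ⊲ (λ z → ∃ λ y → Σ (y ∈ C) λ p → z ∈ D y p)
    refinement   : ∀ {x y C} → x ⪯ y → x ⊲ C → ∃ λ C′ → C′ ⊆ ↑ C × y ⊲ C′
    ·-assoc  : ∀ x y z → (x · y) · z ≡ x · (y · z)
    ·-mono   : ∀ {x x′ y y′} → x ⪯ x′ → y ⪯ y′ → x · y ⪯ x′ · y′
    ·-identityˡ : ∀ x → ε · x ≡ x
    ·-identityʳ : ∀ x → x · ε ≡ x
    ⊲-·ʳ : ∀ {x C} y → x ⊲ C → x · y ⊲ C ·ₛ ｛ y ｝ℓ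
    ⊲-·ˡ : ∀ {x C} y → x ⊲ C → y · x ⊲ ｛ y ｝ℓ ·ₛ C
    ⊲-ε  : ∀ {x C} → x ⊲ C → C ⊆ ↑₁ ε → ε ⪯ x
    𝟎-prop     : IsProposition 𝟎
    I⊆↑ε       : I ⊆ ↑₁ ε
    I-·-closed : ∀ {x y} → x ∈ I → y ∈ I → x · y ∈ I
    ε∈I        : ε ∈ I
    ε⊲I        : ε ⊲ I
    I-idem     : ∀ {x} → x ∈ I → x ≡ x · x
    I-central  : ∀ {x} → x ∈ I → ∀ y → x · y ≡ y · x
    R-⪯        : ∀ {x y z} → x ⪯ y → R x z → ∃ λ w → z ⪯ w × R y w
    R-cover    : ∀ x (X : Pred S ℓ) → (∃ λ C → x ⊲ C × C ⊆ ⟨R⟩ X) →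
                 ∃ λ y → R x y × ∃ λ C′ → y ⊲ C′ × C′ ⊆ X
    R-I        : ∀ {x y z} → x ∈ I → R y z → R (x · y) (x · z) × R (y · x) (z · x)
    R-refl     : ∀ x → R x x
    R-trans    : ∀ {x y z} → R x y → R y z → R x z
    R-𝟎        : ∀ {x y} → R x y → y ∈ 𝟎 → x ∈ 𝟎
    𝟎-R        : ∀ {x} → x ∈ 𝟎 → ∃ λ y → R x y × y ⊲ ∅ℓ

  _⊗ₚ_ : ∀ {a b} → Pred S a → Pred S b → Pred S (lsuc ℓ ⊔ˡ a ⊔ˡ b)
  X ⊗ₚ Y = j (↑ (X ·ₛ Y))

  𝟏ₚ : Pred S ℓ
  𝟏ₚ = ↑ ｛ ε ｝ℓ

  _⇒ₗₚ_ : ∀ {a b} → Pred S a → Pred S b → Pred S (ℓ ⊔ˡ a ⊔ˡ b)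
  (X ⇒ₗₚ Y) z = (｛ z ｝ℓ ·ₛ X) ⊆ Y

  _⇒ᵣₚ_ : ∀ {a b} → Pred S a → Pred S b → Pred S (ℓ ⊔ˡ a ⊔ˡ b)
  (X ⇒ᵣₚ Y) z = (X ·ₛ ｛ z ｝ℓ) ⊆ Y

  !ₚ : ∀ {a} → Pred S a → Pred S (lsuc ℓ ⊔ˡ a)
  !ₚ X = j (↑ (X ∩ I))

  ?ₚ : ∀ {a} → Pred S a → Pred S (ℓ ⊔ˡ a)
  ?ₚ X = ⟨R⟩ X

  _⊓ₚ_ : ∀ {a b} → Pred S a → Pred S b → Pred S (a ⊔ˡ b)
  X ⊓ₚ Y = X ∩ Y

  _⊔ₚ_ : ∀ {a b} → Pred S a → Pred S b → Pred S (lsuc ℓ ⊔ˡ a ⊔ˡ b)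
  X ⊔ₚ Y = j (X ∪ Y)

  topₚ : Pred S ℓ
  topₚ _ = Lift ℓ ⊤

  botₚ : Pred S (lsuc ℓ)
  botₚ = j ∅ℓ

Strong : ∀ {ℓ} → ModalFLCoverSystem ℓ → Set (lsuc ℓ)
Strong {ℓ} 𝒮 = ∀ (X Y : Pred S ℓ) → IsProposition X → IsProposition Y →
               (X ⊗ₚ Y) ≐ ↑ (X ·ₛ Y)
  where open ModalFLCoverSystem 𝒮

-- Isomorphism between a modal FL-algebra and the modal FL-algebra
-- Prop(𝒮) of propositions of a modal FL-cover system
-- (equality of propositions is extensional equality of subsets).

record IsoToProp {ℓ} (A : ModalFLAlgebra ℓ) (𝒮 : ModalFLCoverSystem ℓ) : Set (lsuc ℓ) where
  open ModalFLAlgebra A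
  open ModalFLCoverSystem 𝒮
  field
    f          : Carrier → Pred S ℓ
    f-prop     : ∀ a → IsProposition (f a)
    injective  : ∀ a b → f a ≐ f b → a ≡ b
    surjective : ∀ (X : Pred S ℓ) → IsProposition X → ∃ λ a → f a ≐ X
    f-order    : ∀ a b → (a ⊑ b) ⇔ (f a ⊆ f b)
    f-⊓   : ∀ a b → f (a ⊓ b) ≐ (f a ⊓ₚ f b)
    f-⊔   : ∀ a b → f (a ⊔ b) ≐ (f a ⊔ₚ f b)
    f-top : f top ≐ topₚ
    f-bot : f bot ≐ botₚ
    f-⊗   : ∀ a b → f (a ⊗ b) ≐ (f a ⊗ₚ f b)
    f-one : f one ≐ 𝟏ₚ
    f-⇒ₗ  : ∀ a b → f (a ⇒ₗ b) ≐ (f a ⇒ₗₚ f b)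
    f-⇒ᵣ  : ∀ a b → f (a ⇒ᵣ b) ≐ (f a ⇒ᵣₚ f b)
    f-zero : f zero ≐ 𝟎
    f-！   : ∀ a → f (！ a) ≐ !ₚ (f a)
    f-？   : ∀ a → f (？ a) ≐ ?ₚ (f a)

-- An order-complete algebra A is its own cover system: take S = A with the
-- order reversed (x ⪯ y iff y ⊑ x), let x ⊲ C mean x ⊑ ⋁ C, let I be the
-- fixed points of !, x R y mean x ⊑ ? y, and 0 = ↓ 0. Then j X = ↓ (⋁ X), so
-- the propositions are exactly the principal down-sets ↓ a, and a ↦ ↓ a is the
-- isomorphism. Strength holds because ↑ (↓ a · ↓ b) is already the principal
-- down-set ↓ (a ⊗ b), as ⊗ is monotone.
module Submission where

open import Defs
open import Level using (Level; lift)
open import Data.Product using (Σ; _×_; _,_; proj₁; proj₂)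
open import Data.Sum using (inj₁; inj₂)
open import Data.Unit using (tt)
open import Function using (id; mk⇔; Equivalence)
open import Relation.Binary.Bundles using (Poset)
open import Relation.Binary.Lattice.Structures using (IsBoundedLattice)
open import Relation.Binary.PropositionalEquality using (_≡_; refl; sym; trans; cong; cong₂; subst; module ≡-Reasoning)
open import Relation.Unary using (Pred; _∈_; _⊆_; _≐_; _∩_; _∪_)
open import Relation.Unary.Properties using (≐-sym; ≐-trans)
open import Algebra.Structures using (IsMonoid)
import Relation.Binary.Reasoning.PartialOrder as PartialOrderReasoning

module ModalFLAlgebraProperties {ℓ : Level} (A : ModalFLAlgebra ℓ) where
  open ModalFLAlgebra A
  open IsBoundedLattice isBoundedLattice public
    using (x≤x∨y; y≤x∨y; ∨-least; x∧y≤x; x∧y≤y; ∧-greatest; maximum; minimum; isPartialOrder)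
    renaming (refl to ⊑-refl; trans to ⊑-trans; antisym to ⊑-antisym)
  open IsMonoid isMonoid using (identityˡ; identityʳ)

  poset : Poset ℓ ℓ ℓ
  poset = record { Carrier = Carrier ; _≈_ = _≡_ ; _≤_ = _⊑_ ; isPartialOrder = isPartialOrder }

  module ⊑-Reasoning = PartialOrderReasoning poset

  ≡⇒⊑ : ∀ {a b} → a ≡ b → a ⊑ b
  ≡⇒⊑ refl = ⊑-refl

  ⊑⇒ₗ⇒⊗⊑ : ∀ {a b c} → a ⊑ b ⇒ₗ c → a ⊗ b ⊑ c
  ⊑⇒ₗ⇒⊗⊑ = Equivalence.to (resₗ _ _ _)

  ⊗⊑⇒⊑⇒ₗ : ∀ {a b c} → a ⊗ b ⊑ c → a ⊑ b ⇒ₗ c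
  ⊗⊑⇒⊑⇒ₗ = Equivalence.from (resₗ _ _ _)

  ⊑⇒ᵣ⇒⊗⊑ : ∀ {a b c} → b ⊑ a ⇒ᵣ c → a ⊗ b ⊑ c
  ⊑⇒ᵣ⇒⊗⊑ = Equivalence.to (resᵣ _ _ _)

  ⊗⊑⇒⊑⇒ᵣ : ∀ {a b c} → a ⊗ b ⊑ c → b ⊑ a ⇒ᵣ c
  ⊗⊑⇒⊑⇒ᵣ = Equivalence.from (resᵣ _ _ _)

  ⊓-idem : ∀ a → a ⊓ a ≡ a
  ⊓-idem a = ⊑-antisym (x∧y≤x a a) (∧-greatest ⊑-refl ⊑-refl)

  ！-⊑-one : ∀ a → ！ a ⊑ one
  ！-⊑-one a = begin
    ！ a          ≡⟨ ！a≡！[a⊓one] ⟩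
    ！ (a ⊓ one)  ≤⟨ s1 (a ⊓ one) ⟩
    a ⊓ one       ≤⟨ x∧y≤y a one ⟩
    one           ∎
    where
    open ⊑-Reasoning
    ！a≡！[a⊓one] : ！ a ≡ ！ (a ⊓ one)
    ！a≡！[a⊓one] = sym (trans (s4 a one) (trans (cong (！ a ⊗_) s3) (identityʳ (！ a))))

  ！-mono : ∀ {a b} → a ⊑ b → ！ a ⊑ ！ b
  ！-mono {a} {b} a⊑b = begin
    ！ a          ≡⟨ cong ！ (sym a⊓b≡a) ⟩
    ！ (a ⊓ b)    ≡⟨ s4 a b ⟩
    ！ a ⊗ ！ b   ≤⟨ ⊗-mono (！-⊑-one a) ⊑-refl ⟩
    one ⊗ ！ b    ≡⟨ identityˡ (！ b) ⟩
    ！ b          ∎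
    where
    open ⊑-Reasoning
    a⊓b≡a : a ⊓ b ≡ a
    a⊓b≡a = ⊑-antisym (x∧y≤x a b) (∧-greatest ⊑-refl a⊑b)

  ！-idem : ∀ a → ！ (！ a) ≡ ！ a
  ！-idem a = ⊑-antisym (s1 (！ a)) (s2 a)

  ？-mono : ∀ {a b} → a ⊑ b → ？ a ⊑ ？ b
  ？-mono {a} {b} a⊑b = begin
    ？ a          ≡⟨ identityˡ (？ a) ⟨
    one ⊗ ？ a    ≤⟨ ⊑⇒ₗ⇒⊗⊑ one⊑？a⇒ₗ？b ⟩
    ？ b          ∎
    where
    open ⊑-Reasoning
    one⊑a⇒ₗb : one ⊑ a ⇒ₗ b
    one⊑a⇒ₗb = ⊗⊑⇒⊑⇒ₗ (⊑-trans (≡⇒⊑ (identityˡ a)) a⊑b)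
    one⊑？a⇒ₗ？b : one ⊑ ？ a ⇒ₗ ？ b
    one⊑？a⇒ₗ？b = ⊑-trans (≡⇒⊑ (sym s3)) (⊑-trans (！-mono one⊑a⇒ₗb) (c1ₗ a b))

  ！-Fixed : Pred Carrier ℓ
  ！-Fixed x = x ≡ ！ x

  ！-Fixed-⊗-closed : ∀ {x y} → x ∈ ！-Fixed → y ∈ ！-Fixed → x ⊗ y ∈ ！-Fixed
  ！-Fixed-⊗-closed {x} {y} x≡！x y≡！y = begin
    x ⊗ y             ≡⟨ x⊗y≡！[x⊓y] ⟩
    ！ (x ⊓ y)        ≡⟨ ！-idem (x ⊓ y) ⟨
    ！ (！ (x ⊓ y))   ≡⟨ cong ！ x⊗y≡！[x⊓y] ⟨
    ！ (x ⊗ y)        ∎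
    where
    open ≡-Reasoning
    x⊗y≡！[x⊓y] : x ⊗ y ≡ ！ (x ⊓ y)
    x⊗y≡！[x⊓y] = trans (cong₂ _⊗_ x≡！x y≡！y) (sym (s4 x y))

  ！-Fixed-idem : ∀ {x} → x ∈ ！-Fixed → x ≡ x ⊗ x
  ！-Fixed-idem {x} x≡！x = begin
    x             ≡⟨ x≡！x ⟩
    ！ x          ≡⟨ cong ！ (⊓-idem x) ⟨
    ！ (x ⊓ x)    ≡⟨ s4 x x ⟩
    ！ x ⊗ ！ x   ≡⟨ cong₂ _⊗_ x≡！x x≡！x ⟨
    x ⊗ x         ∎
    where open ≡-Reasoning

  ！-Fixed-central : ∀ {x} → x ∈ ！-Fixed → ∀ y → x ⊗ y ≡ y ⊗ x
  ！-Fixed-central {x} x≡！x y = subst (λ z → z ⊗ y ≡ y ⊗ z) (sym x≡！x) (s5 x y)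

  -- Both are (c1) applied to ! a ⊑ b ⇒ c (a ⊗ b), after replacing ! a by ! ! a.
  ！⊗？⊑？⊗ : ∀ a b → ！ a ⊗ ？ b ⊑ ？ (！ a ⊗ b)
  ！⊗？⊑？⊗ a b = ⊑⇒ₗ⇒⊗⊑ (begin
    ！ a                       ≡⟨ ！-idem a ⟨
    ！ (！ a)                  ≤⟨ ！-mono (⊗⊑⇒⊑⇒ₗ ⊑-refl) ⟩
    ！ (b ⇒ₗ (！ a ⊗ b))       ≤⟨ c1ₗ b (！ a ⊗ b) ⟩
    ？ b ⇒ₗ ？ (！ a ⊗ b)      ∎)
    where open ⊑-Reasoning

  ？⊗！⊑？⊗ : ∀ a b → ？ b ⊗ ！ a ⊑ ？ (b ⊗ ！ a)
  ？⊗！⊑？⊗ a b = ⊑⇒ᵣ⇒⊗⊑ (begin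
    ！ a                       ≡⟨ ！-idem a ⟨
    ！ (！ a)                  ≤⟨ ！-mono (⊗⊑⇒⊑⇒ᵣ ⊑-refl) ⟩
    ！ (b ⇒ᵣ (b ⊗ ！ a))       ≤⟨ c1ᵣ b (b ⊗ ！ a) ⟩
    ？ b ⇒ᵣ ？ (b ⊗ ！ a)      ∎)
    where open ⊑-Reasoning

module CanonicalCoverSystem {ℓ : Level} (A : ModalFLAlgebra ℓ) (complete : OrderComplete A) where
  open ModalFLAlgebra A
  open ModalFLAlgebraProperties A
  open IsMonoid isMonoid using (assoc; identityˡ; identityʳ)

  ⋁ : Pred Carrier ℓ → Carrier
  ⋁ P = proj₁ (proj₁ (complete P))

  ⋁-isJoin : ∀ P → IsJoin A P (⋁ P)
  ⋁-isJoin P = proj₂ (proj₁ (complete P))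

  ⋁-upper : ∀ P {x} → x ∈ P → x ⊑ ⋁ P
  ⋁-upper P = proj₁ (⋁-isJoin P) _

  ⋁-least : ∀ P {b} → (∀ x → x ∈ P → x ⊑ b) → ⋁ P ⊑ b
  ⋁-least P = proj₂ (⋁-isJoin P) _

  ⋁-mono : ∀ {P Q} → P ⊆ Q → ⋁ P ⊑ ⋁ Q
  ⋁-mono {P} {Q} P⊆Q = ⋁-least P (λ x x∈P → ⋁-upper Q (P⊆Q x∈P))

  _⪯_ : Carrier → Carrier → Set ℓ
  x ⪯ y = y ⊑ x

  _⊲_ : Carrier → Pred Carrier ℓ → Set ℓ
  x ⊲ C = x ⊑ ⋁ C

  open CoverNotions _⪯_ _⊲_ _⊗_

  ↓ : Carrier → Pred Carrier ℓ
  ↓ a x = x ⊑ a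

  -- ⊗ preserves joins in each argument because it is residuated.
  ⋁-⊗ʳ : ∀ C y → ⋁ C ⊗ y ⊑ ⋁ (C ·ₛ ｛ y ｝ℓ)
  ⋁-⊗ʳ C y = ⊑⇒ₗ⇒⊗⊑ (⋁-least C (λ c c∈C →
    ⊗⊑⇒⊑⇒ₗ (⋁-upper (C ·ₛ ｛ y ｝ℓ) (c , y , c∈C , refl , refl))))

  ⋁-⊗ˡ : ∀ C y → y ⊗ ⋁ C ⊑ ⋁ (｛ y ｝ℓ ·ₛ C)
  ⋁-⊗ˡ C y = ⊑⇒ᵣ⇒⊗⊑ (⋁-least C (λ c c∈C →
    ⊗⊑⇒⊑⇒ᵣ (⋁-upper (｛ y ｝ℓ ·ₛ C) (y , c , refl , c∈C , refl))))

  ↓-isProposition : ∀ a → IsProposition (↓ a)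
  ↓-isProposition a = (λ { (x , x⊑a , y⊑x) → ⊑-trans y⊑x x⊑a })
                    , (λ { (C , x⊑⋁C , C⊆↓a) → ⊑-trans x⊑⋁C (⋁-least C (λ c c∈C → C⊆↓a c∈C)) })

  j≐↓ : ∀ {X t} → IsJoin A X t → j X ≐ ↓ t
  j≐↓ {X} (upper , least) =
      (λ { (C , x⊑⋁C , C⊆X) → ⊑-trans x⊑⋁C (⋁-least C (λ c c∈C → upper c (C⊆X c∈C))) })
    , (λ x⊑t → X , ⊑-trans x⊑t (least (⋁ X) (λ _ → ⋁-upper X)) , id)

  j≐↓-principal : ∀ {X t} → X ≐ ↓ t → j X ≐ ↓ t
  j≐↓-principal (X⊆↓t , ↓t⊆X) = j≐↓ ((λ _ → X⊆↓t) , (λ b upper → upper _ (↓t⊆X ⊑-refl)))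

  ⋁∈proposition : ∀ {X} → IsProposition X → ⋁ X ∈ X
  ⋁∈proposition {X} (_ , jX⊆X) = jX⊆X (X , ⊑-refl , id)

  proposition≐↓⋁ : ∀ {X} → IsProposition X → X ≐ ↓ (⋁ X)
  proposition≐↓⋁ {X} X-prop@(upward , _) =
    ⋁-upper X , (λ x⊑⋁X → upward (⋁ X , ⋁∈proposition X-prop , x⊑⋁X))

  ↑·-greatest : ∀ {X Y : Pred Carrier ℓ} {a b} → a ∈ X → X ⊆ ↓ a → b ∈ Y → Y ⊆ ↓ b → ↑ (X ·ₛ Y) ≐ ↓ (a ⊗ b)
  ↑·-greatest {a = a} {b} a∈X X⊆↓a b∈Y Y⊆↓b =
      (λ { (_ , (x , y , x∈X , y∈Y , refl) , z⊑x⊗y) → ⊑-trans z⊑x⊗y (⊗-mono (X⊆↓a x∈X) (Y⊆↓b y∈Y)) })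
    , (λ z⊑a⊗b → a ⊗ b , (a , b , a∈X , b∈Y , refl) , z⊑a⊗b)

  ↑[↓∩！-Fixed] : ∀ a → ↑ (↓ a ∩ ！-Fixed) ≐ ↓ (！ a)
  ↑[↓∩！-Fixed] a =
      (λ { (w , (w⊑a , w≡！w) , z⊑w) → ⊑-trans z⊑w (⊑-trans (≡⇒⊑ w≡！w) (！-mono w⊑a)) })
    , (λ z⊑！a → ！ a , (s1 a , sym (！-idem a)) , z⊑！a)

  ↓-⊔-isJoin : ∀ a b → IsJoin A (↓ a ∪ ↓ b) (a ⊔ b)
  ↓-⊔-isJoin a b = (λ { x (inj₁ x⊑a) → ⊑-trans x⊑a (x≤x∨y a b) ; x (inj₂ x⊑b) → ⊑-trans x⊑b (y≤x∨y a b) })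
                 , (λ c upper → ∨-least (upper a (inj₁ ⊑-refl)) (upper b (inj₂ ⊑-refl)))

  ∅-isJoin : IsJoin A ∅ℓ bot
  ∅-isJoin = (λ { _ (lift ()) }) , (λ c _ → minimum c)

  ！-Fixed-R : ∀ {x y z} → x ∈ ！-Fixed → y ⊑ ？ z → x ⊗ y ⊑ ？ (x ⊗ z) × y ⊗ x ⊑ ？ (z ⊗ x)
  ！-Fixed-R {x} {y} {z} x≡！x y⊑？z =
      ⊑-trans (⊗-mono ⊑-refl y⊑？z) (subst (λ w → w ⊗ ？ z ⊑ ？ (w ⊗ z)) (sym x≡！x) (！⊗？⊑？⊗ x z))
    , ⊑-trans (⊗-mono y⊑？z ⊑-refl) (subst (λ w → ？ z ⊗ w ⊑ ？ (z ⊗ w)) (sym x≡！x) (？⊗！⊑？⊗ x z))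

  coverSystem : ModalFLCoverSystem ℓ
  coverSystem = record
    { S = Carrier
    ; _⪯_ = _⪯_
    ; _⊲_ = _⊲_
    ; _·_ = _⊗_
    ; ε = one
    ; 𝟎 = ↓ zero
    ; I = ！-Fixed
    ; R = λ x y → x ⊑ ？ y
    ; ⪯-refl = λ _ → ⊑-refl
    ; ⪯-trans = λ x⪯y y⪯z → ⊑-trans y⪯z x⪯y
    ; ⊲-ext = λ x⊑⋁C C≐C′ → ⊑-trans x⊑⋁C (⋁-mono (proj₁ C≐C′))
    ; existence = λ x → ｛ x ｝ℓ , ⋁-upper ｛ x ｝ℓ refl , ≡⇒⊑
    ; transitivity = λ {_} {C} x⊑⋁C D y⊑⋁D → ⊑-trans x⊑⋁C (⋁-least C (λ y y∈C →
        ⊑-trans (y⊑⋁D y y∈C) (⋁-least (D y y∈C) (λ z z∈D → ⋁-upper _ (y , y∈C , z∈D)))))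
    ; refinement = λ {C = C} y⊑x x⊑⋁C → C , (λ {z} z∈C → z , z∈C , ⊑-refl) , ⊑-trans y⊑x x⊑⋁C
    ; ·-assoc = assoc
    ; ·-mono = ⊗-mono
    ; ·-identityˡ = identityˡ
    ; ·-identityʳ = identityʳ
    ; ⊲-·ʳ = λ {C = C} y x⊑⋁C → ⊑-trans (⊗-mono x⊑⋁C ⊑-refl) (⋁-⊗ʳ C y)
    ; ⊲-·ˡ = λ {C = C} y x⊑⋁C → ⊑-trans (⊗-mono ⊑-refl x⊑⋁C) (⋁-⊗ˡ C y)
    ; ⊲-ε = λ {C = C} x⊑⋁C C⊆↓one → ⊑-trans x⊑⋁C (⋁-least C (λ c c∈C → C⊆↓one c∈C))
    ; 𝟎-prop = ↓-isProposition zero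
    ; I⊆↑ε = λ {x} x≡！x → subst (_⊑ one) (sym x≡！x) (！-⊑-one x)
    ; I-·-closed = ！-Fixed-⊗-closed
    ; ε∈I = sym s3
    ; ε⊲I = ⋁-upper ！-Fixed (sym s3)
    ; I-idem = ！-Fixed-idem
    ; I-central = ！-Fixed-central
    ; R-⪯ = λ {z = z} y⊑x x⊑？z → z , ⊑-refl , ⊑-trans y⊑x x⊑？z
    ; R-cover = λ { x X (C , x⊑⋁C , C⊆⟨R⟩X) → ⋁ X
        , ⊑-trans x⊑⋁C (⋁-least C (λ c c∈C → let (v , c⊑？v , v∈X) = C⊆⟨R⟩X c∈C in
            ⊑-trans c⊑？v (？-mono (⋁-upper X v∈X))))
        , X , ⊑-refl , id }
    ; R-I = ！-Fixed-R
    ; R-refl = c2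
    ; R-trans = λ x⊑？y y⊑？z → ⊑-trans x⊑？y (⊑-trans (？-mono y⊑？z) (c3 _))
    ; R-𝟎 = λ x⊑？y y⊑zero → ⊑-trans x⊑？y (⊑-trans (？-mono y⊑zero) c4)
    ; 𝟎-R = λ x⊑zero → bot , ⊑-trans x⊑zero (c5 bot) , minimum _
    }

  strong : Strong coverSystem
  strong X Y X-prop Y-prop = ≐-trans (j≐↓-principal ↑X·Y≐↓) (≐-sym ↑X·Y≐↓)
    where
    ↑X·Y≐↓ : ↑ (X ·ₛ Y) ≐ ↓ (⋁ X ⊗ ⋁ Y)
    ↑X·Y≐↓ = ↑·-greatest (⋁∈proposition X-prop) (⋁-upper X) (⋁∈proposition Y-prop) (⋁-upper Y)

  ↓-⇒ₗ : ∀ a b → ↓ (a ⇒ₗ b) ≐ (λ z → (｛ z ｝ℓ ·ₛ ↓ a) ⊆ ↓ b)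
  ↓-⇒ₗ a b = (λ z⊑a⇒b → λ { (_ , x , refl , x⊑a , refl) → ⊑-trans (⊗-mono ⊑-refl x⊑a) (⊑⇒ₗ⇒⊗⊑ z⊑a⇒b) })
           , (λ {z} z·↓a⊆↓b → ⊗⊑⇒⊑⇒ₗ (z·↓a⊆↓b (z , a , refl , ⊑-refl , refl)))

  ↓-⇒ᵣ : ∀ a b → ↓ (a ⇒ᵣ b) ≐ (λ z → (↓ a ·ₛ ｛ z ｝ℓ) ⊆ ↓ b)
  ↓-⇒ᵣ a b = (λ z⊑a⇒b → λ { (x , _ , x⊑a , refl , refl) → ⊑-trans (⊗-mono x⊑a ⊑-refl) (⊑⇒ᵣ⇒⊗⊑ z⊑a⇒b) })
           , (λ {z} ↓a·z⊆↓b → ⊗⊑⇒⊑⇒ᵣ (↓a·z⊆↓b (a , z , ⊑-refl , refl , refl)))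

  principalDownSets : IsoToProp A coverSystem
  principalDownSets = record
    { f = ↓
    ; f-prop = ↓-isProposition
    ; injective = λ a b ↓a≐↓b → ⊑-antisym (proj₁ ↓a≐↓b ⊑-refl) (proj₂ ↓a≐↓b ⊑-refl)
    ; surjective = λ X X-prop → ⋁ X , ≐-sym (proposition≐↓⋁ X-prop)
    ; f-order = λ a b → mk⇔ (λ a⊑b {x} x⊑a → ⊑-trans x⊑a a⊑b) (λ ↓a⊆↓b → ↓a⊆↓b ⊑-refl)
    ; f-⊓ = λ a b → (λ x⊑a⊓b → ⊑-trans x⊑a⊓b (x∧y≤x a b) , ⊑-trans x⊑a⊓b (x∧y≤y a b))
                  , (λ (x⊑a , x⊑b) → ∧-greatest x⊑a x⊑b)
    ; f-⊔ = λ a b → ≐-sym (j≐↓ (↓-⊔-isJoin a b))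
    ; f-top = (λ _ → lift tt) , (λ _ → maximum _)
    ; f-bot = ≐-sym (j≐↓ ∅-isJoin)
    ; f-⊗ = λ a b → ≐-sym (j≐↓-principal (↑·-greatest ⊑-refl id ⊑-refl id))
    ; f-one = (λ x⊑one → one , refl , x⊑one) , (λ { (_ , refl , x⊑one) → x⊑one })
    ; f-⇒ₗ = ↓-⇒ₗ
    ; f-⇒ᵣ = ↓-⇒ᵣ
    ; f-zero = id , id
    ; f-！ = λ a → ≐-sym (j≐↓-principal (↑[↓∩！-Fixed] a))
    ; f-？ = λ a → (λ x⊑？a → a , x⊑？a , ⊑-refl) , (λ { (v , x⊑？v , v⊑a) → ⊑-trans x⊑？v (？-mono v⊑a) })
    }

theorem3 : ∀ {ℓ : Level} (A : ModalFLAlgebra ℓ) → OrderComplete A →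
           Σ (ModalFLCoverSystem ℓ) λ 𝒮 → Strong 𝒮 × IsoToProp A 𝒮
theorem3 A complete = coverSystem , strong , principalDownSets
  where open CanonicalCoverSystem A complete
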